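{- For all integers $m,n\ge0$, $$\sum_{j=0}^{n}\sum_{l=0}^{m}S_1(n,j)S_1(m,l)B_{j+l}=\sum_{k=0}^{m}(-1)^{m+n-k}\binom{m}{k}\binom{n}{k}\frac{k!\,(m+n-k)!}{m+n-k+1}.$$
   Context: The (signed) Stirling numbers of the first kind $S_1(n,k)$ are defined by $x(x-1)\cdots(x-n+1)=\sum_{k=0}^nS_1(n,k)x^k$. The Bernoulli numbers $B_n$ are defined by $\frac{t}{e^t-1}=\sum_{n\ge0}B_n\frac{t^n}{n!}$. $\binom{n}{k}=0$ for $k>n$. -}

module Defs where

open import Data.Nat as ℕ using (ℕ; zero; suc)
open import Data.Nat.Combinatorics using (_C_)
open import Data.Integer as ℤ using (ℤ; +_; -[1+_])
open import Data.List using (List; []; _∷_; map; sum; upTo; lookup)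
open import Data.Rational as ℚ using (ℚ; _/_)

-- Polynomials with integer coefficients as coefficient lists (constant term first).
Poly : Set
Poly = List ℤ

_⊕_ : Poly → Poly → Poly
[] ⊕ q = q
(a ∷ p) ⊕ [] = a ∷ p
(a ∷ p) ⊕ (b ∷ q) = (a ℤ.+ b) ∷ (p ⊕ q)

mulXminus : ℤ → Poly → Poly
mulXminus c p = (0ℤ ∷ p) ⊕ map (λ a → ℤ.- (c ℤ.* a)) p
  where 0ℤ = + 0

falling : ℕ → Poly
falling zero = + 1 ∷ []
falling (suc n) = mulXminus (+ n) (falling n)

coeff : Poly → ℕ → ℤ
coeff [] k = + 0
coeff (a ∷ p) zero = a
coeff (a ∷ p) (suc k) = coeff p k

S₁ : ℕ → ℕ → ℤ
S₁ n k = coeff (falling n) k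

sumTo : ℕ → (ℕ → ℚ) → ℚ
sumTo n f = sum-go (upTo (suc n))
  where
  sum-go : List ℕ → ℚ
  sum-go [] = ℚ.0ℚ
  sum-go (i ∷ is) = f i ℚ.+ sum-go is

-- Bernoulli numbers with t/(e^t-1) = Σ B_n t^n/n!, i.e. B₀ = 1 and
-- Σ_{k=0}^{n} C(n+1,k) B_k = 0 for n ≥ 1, so
-- B_n = -(1/(n+1)) Σ_{k<n} C(n+1,k) B_k.
private
  Bs : ℕ → List ℚ   -- Bs n = [B_n, ..., B_0] (reversed)
  Bs zero = ℚ.1ℚ ∷ []
  Bs (suc n) = Bnew ∷ prev
    where
    prev = Bs n
    -- prev = [B_n,...,B_0]; pair B_{n-i} with C(n+2, n-i)
    acc : ℕ → List ℚ → ℚ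
    acc i [] = ℚ.0ℚ
    acc i (b ∷ bs) = (((+ (suc (suc n) C (n ℕ.∸ i))) / 1) ℚ.* b) ℚ.+ acc (suc i) bs
    Bnew = ℚ.- ((+ 1 / suc (suc n)) ℚ.* acc 0 prev)

  hd : List ℚ → ℚ
  hd [] = ℚ.0ℚ
  hd (b ∷ _) = b

B : ℕ → ℚ
B n = hd (Bs n)

ℤ→ℚ : ℤ → ℚ
ℤ→ℚ z = z / 1

sgn : ℕ → ℚ
sgn zero = ℚ.1ℚ
sgn (suc e) = ℚ.- (sgn e)

-- Let L_φ be the linear functional on ℚ[x] with L_φ(xʲ) = φ j, and write moment n φ = L_φ((x)ₙ) for the
-- falling factorial (x)ₙ = Σⱼ S₁(n,j) xʲ. The left-hand side is L_B((x)ₙ(x)ₘ) with φ = B, and the product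
-- formula (x)ₙ(x)ₘ = Σₖ C(m,k) C(n,k) k! (x)_{m+n-k} reduces it to the values L_B((x)_N). The Bernoulli
-- recurrence says L_B((x+1)ⁱ - xⁱ) = [i = 1]; as (x+1)_{N+1} - (x)_{N+1} = (N+1)(x)_N, this gives
-- (N+1) L_B((x)_N) = [x¹](x)_{N+1} = (-1)ᴺ N!.
module Submission where

open import Defs
open import Data.Nat as ℕ using (ℕ; _+_; _∸_; _!)
open import Data.Nat.Combinatorics using (_C_)
open import Data.Integer using (+_)
open import Data.Rational as ℚ using (ℚ; _/_)
open import Relation.Binary.PropositionalEquality using (_≡_)

open import Data.Nat using (zero; suc; _<_; _≤_; s≤s; z≤n; _≤?_)
open import Data.Nat.Combinatorics using (nCn≡1; nC1≡n; nCk≡nC[n∸k]; nCk+nC[k+1]≡[n+1]C[k+1]; k>n⇒nCk≡0)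
import Data.Nat.Properties as ℕP
import Data.Nat.Solver as ℕSolver
open import Data.Integer using (ℤ)
import Data.Integer as ℤ
import Data.Integer.Properties as ℤP
open import Data.Rational using (0ℚ; 1ℚ; fromℚᵘ)
  renaming (_+_ to _+q_; _*_ to _*q_; -_ to -q_)
import Data.Rational.Properties as ℚP
import Data.Rational.Solver as ℚSolver
import Data.Rational.Unnormalised as ℚᵘ
import Data.Rational.Unnormalised.Properties as ℚᵘP
open import Data.Rational.Unnormalised using (mkℚᵘ; *≡*)
open import Data.List using (List; []; _∷_; map; applyUpTo)
open import Data.Product using (Σ; _,_; proj₁)
open import Function using (_∘_)
open import Relation.Nullary using (yes; no)
open import Relation.Binary.PropositionalEquality using (refl; sym; trans; cong; cong₂; module ≡-Reasoning)

nC[k+1]*[k+1]≡nCk*[n∸k] : ∀ n k → (n C suc k) ℕ.* suc k ≡ (n C k) ℕ.* (n ∸ k)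
nC[k+1]*[k+1]≡nCk*[n∸k] zero    k       = begin
  (0 C suc k) ℕ.* suc k  ≡⟨ cong (ℕ._* suc k) (k>n⇒nCk≡0 {0} {suc k} (s≤s z≤n)) ⟩
  0                      ≡⟨ ℕP.*-zeroʳ (0 C k) ⟨
  (0 C k) ℕ.* 0          ≡⟨ cong (λ d → (0 C k) ℕ.* d) (ℕP.0∸n≡0 k) ⟨
  (0 C k) ℕ.* (0 ∸ k)    ∎
  where open ≡-Reasoning
nC[k+1]*[k+1]≡nCk*[n∸k] (suc n) zero    =
  trans (ℕP.*-identityʳ (suc n C 1)) (trans (nC1≡n (suc n)) (sym (ℕP.*-identityˡ (suc n))))
nC[k+1]*[k+1]≡nCk*[n∸k] (suc n) (suc k) = begin
  (suc n C suc (suc k)) ℕ.* suc (suc k)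
    ≡⟨ cong (ℕ._* suc (suc k)) (sym (nCk+nC[k+1]≡[n+1]C[k+1] n (suc k))) ⟩
  (n C suc k + n C suc (suc k)) ℕ.* suc (suc k)
    ≡⟨ ℕP.*-distribʳ-+ (suc (suc k)) (n C suc k) (n C suc (suc k)) ⟩
  (n C suc k) ℕ.* suc (suc k) + (n C suc (suc k)) ℕ.* suc (suc k)
    ≡⟨ cong (λ d → (n C suc k) ℕ.* suc (suc k) + d) (nC[k+1]*[k+1]≡nCk*[n∸k] n (suc k)) ⟩
  (n C suc k) ℕ.* suc (suc k) + (n C suc k) ℕ.* (n ∸ suc k)
    ≡⟨ sym (ℕP.*-distribˡ-+ (n C suc k) (suc (suc k)) (n ∸ suc k)) ⟩
  (n C suc k) ℕ.* (suc (suc k) + (n ∸ suc k))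
    ≡⟨ regroup ⟩
  (n C suc k) ℕ.* (suc k + (n ∸ k))
    ≡⟨ ℕP.*-distribˡ-+ (n C suc k) (suc k) (n ∸ k) ⟩
  (n C suc k) ℕ.* suc k + (n C suc k) ℕ.* (n ∸ k)
    ≡⟨ cong (λ d → d + (n C suc k) ℕ.* (n ∸ k)) (nC[k+1]*[k+1]≡nCk*[n∸k] n k) ⟩
  (n C k) ℕ.* (n ∸ k) + (n C suc k) ℕ.* (n ∸ k)
    ≡⟨ sym (ℕP.*-distribʳ-+ (n ∸ k) (n C k) (n C suc k)) ⟩
  (n C k + n C suc k) ℕ.* (n ∸ k)
    ≡⟨ cong (ℕ._* (n ∸ k)) (nCk+nC[k+1]≡[n+1]C[k+1] n k) ⟩
  (suc n C suc k) ℕ.* (suc n ∸ suc k) ∎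
  where
  open ≡-Reasoning
  regroup : (n C suc k) ℕ.* (suc (suc k) + (n ∸ suc k)) ≡ (n C suc k) ℕ.* (suc k + (n ∸ k))
  regroup with suc k ≤? n
  ... | yes k<n = cong (λ d → (n C suc k) ℕ.* d)
    (trans (sym (ℕP.+-suc (suc k) (n ∸ suc k))) (cong (λ d → suc k + d) (sym (ℕP.+-∸-assoc 1 k<n))))
  ... | no  k≮n = trans (cong (ℕ._* (suc (suc k) + (n ∸ suc k))) (k>n⇒nCk≡0 (ℕP.≰⇒> k≮n)))
                        (sym (cong (ℕ._* (suc k + (n ∸ k))) (k>n⇒nCk≡0 (ℕP.≰⇒> k≮n))))

matchings : ℕ → ℕ → ℕ → ℕ
matchings m n k = (m C k) ℕ.* (n C k) ℕ.* (k !)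

matchings-suc : ∀ m n k → matchings m (suc n) (suc k) ≡ matchings m n (suc k) + matchings m n k ℕ.* (m ∸ k)
matchings-suc m n k = begin
  (m C suc k) ℕ.* (suc n C suc k) ℕ.* (suc k ℕ.* k !)
    ≡⟨ cong (λ c → (m C suc k) ℕ.* c ℕ.* (suc k ℕ.* k !)) (sym (nCk+nC[k+1]≡[n+1]C[k+1] n k)) ⟩
  (m C suc k) ℕ.* (n C k + n C suc k) ℕ.* (suc k ℕ.* k !)
    ≡⟨ solve 5 (λ a b b′ s f → a :* (b :+ b′) :* (s :* f) := a :* b′ :* (s :* f) :+ (a :* s) :* b :* f)
         refl (m C suc k) (n C k) (n C suc k) (suc k) (k !) ⟩
  matchings m n (suc k) + (m C suc k) ℕ.* suc k ℕ.* (n C k) ℕ.* (k !)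
    ≡⟨ cong (λ c → matchings m n (suc k) + c ℕ.* (n C k) ℕ.* (k !)) (nC[k+1]*[k+1]≡nCk*[n∸k] m k) ⟩
  matchings m n (suc k) + (m C k) ℕ.* (m ∸ k) ℕ.* (n C k) ℕ.* (k !)
    ≡⟨ cong (λ d → matchings m n (suc k) + d) (solve 4 (λ a d b f → a :* d :* b :* f := a :* b :* f :* d)
         refl (m C k) (m ∸ k) (n C k) (k !)) ⟩
  matchings m n (suc k) + matchings m n k ℕ.* (m ∸ k) ∎
  where
  open ≡-Reasoning
  open ℕSolver.+-*-Solver

open ℚSolver.+-*-Solver using (solve; _:=_; _:+_; _:*_; :-_; con)

∑ : ℕ → (ℕ → ℚ) → ℚ
∑ zero    f = 0ℚ
∑ (suc n) f = f 0 +q ∑ n (f ∘ suc)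

syntax ∑ n (λ i → e) = ∑[ i < n ] e

∑-cong : ∀ n {f g : ℕ → ℚ} → (∀ i → i < n → f i ≡ g i) → ∑ n f ≡ ∑ n g
∑-cong zero    f≗g = refl
∑-cong (suc n) f≗g = cong₂ _+q_ (f≗g 0 (s≤s z≤n)) (∑-cong n (λ i i<n → f≗g (suc i) (s≤s i<n)))

∑-vanishing : ∀ n {f : ℕ → ℚ} → (∀ i → i < n → f i ≡ 0ℚ) → ∑ n f ≡ 0ℚ
∑-vanishing zero    f≗0 = refl
∑-vanishing (suc n) f≗0 =
  cong₂ _+q_ (f≗0 0 (s≤s z≤n)) (∑-vanishing n (λ i i<n → f≗0 (suc i) (s≤s i<n)))

∑-distrib-+ : ∀ n (f g : ℕ → ℚ) → ∑[ i < n ] (f i +q g i) ≡ ∑ n f +q ∑ n g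
∑-distrib-+ zero    f g = refl
∑-distrib-+ (suc n) f g = trans (cong (f 0 +q g 0 +q_) (∑-distrib-+ n (f ∘ suc) (g ∘ suc)))
  (solve 4 (λ a b c d → (a :+ b) :+ (c :+ d) := (a :+ c) :+ (b :+ d)) refl
    (f 0) (g 0) (∑ n (f ∘ suc)) (∑ n (g ∘ suc)))

∑-distribˡ-* : ∀ n c (f : ℕ → ℚ) → ∑[ i < n ] (c *q f i) ≡ c *q ∑ n f
∑-distribˡ-* zero    c f = sym (ℚP.*-zeroʳ c)
∑-distribˡ-* (suc n) c f =
  trans (cong (c *q f 0 +q_) (∑-distribˡ-* n c (f ∘ suc))) (sym (ℚP.*-distribˡ-+ c (f 0) _))

∑-sub-scaled : ∀ n x (f g : ℕ → ℚ) → ∑ n f +q -q (x *q ∑ n g) ≡ ∑[ i < n ] (f i +q -q (x *q g i))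
∑-sub-scaled zero    x f g = solve 1 (λ x → con 0ℚ :+ :- (x :* con 0ℚ) := con 0ℚ) refl x
∑-sub-scaled (suc n) x f g = begin
  f 0 +q ∑ n (f ∘ suc) +q -q (x *q (g 0 +q ∑ n (g ∘ suc)))
    ≡⟨ solve 5 (λ x a b c d → a :+ c :+ :- (x :* (b :+ d)) := a :+ :- (x :* b) :+ (c :+ :- (x :* d))) refl
         x (f 0) (g 0) (∑ n (f ∘ suc)) (∑ n (g ∘ suc)) ⟩
  f 0 +q -q (x *q g 0) +q (∑ n (f ∘ suc) +q -q (x *q ∑ n (g ∘ suc)))
    ≡⟨ cong (f 0 +q -q (x *q g 0) +q_) (∑-sub-scaled n x (f ∘ suc) (g ∘ suc)) ⟩
  ∑[ i < suc n ] (f i +q -q (x *q g i)) ∎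
  where open ≡-Reasoning

∑-last : ∀ n (f : ℕ → ℚ) → ∑ (suc n) f ≡ ∑ n f +q f n
∑-last zero    f = trans (ℚP.+-identityʳ (f 0)) (sym (ℚP.+-identityˡ (f 0)))
∑-last (suc n) f = trans (cong (f 0 +q_) (∑-last n (f ∘ suc))) (sym (ℚP.+-assoc (f 0) _ _))

∑-merge-shifted : ∀ n (f g : ℕ → ℚ) →
  ∑ (suc n) f +q ∑ (suc n) g ≡ f 0 +q ∑[ k < n ] (f (suc k) +q g k) +q g n
∑-merge-shifted n f g = begin
  f 0 +q ∑ n (f ∘ suc) +q ∑ (suc n) g
    ≡⟨ cong (f 0 +q ∑ n (f ∘ suc) +q_) (∑-last n g) ⟩
  f 0 +q ∑ n (f ∘ suc) +q (∑ n g +q g n)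
    ≡⟨ solve 4 (λ a b c d → a :+ b :+ (c :+ d) := a :+ (b :+ c) :+ d) refl (f 0) (∑ n (f ∘ suc)) (∑ n g) (g n) ⟩
  f 0 +q (∑ n (f ∘ suc) +q ∑ n g) +q g n
    ≡⟨ cong (λ s → f 0 +q s +q g n) (sym (∑-distrib-+ n (f ∘ suc) g)) ⟩
  f 0 +q ∑[ k < n ] (f (suc k) +q g k) +q g n ∎
  where open ≡-Reasoning

-- The loop of `sumTo` is local to its definition; unification through a with-abstraction recovers it.
mutual
  sumToLoop : ℕ → (ℕ → ℚ) → List ℕ → ℚ
  sumToLoop = _

  sumTo-unfold : ∀ n f → sumTo n f ≡ f 0 +q sumToLoop n f (applyUpTo suc n)
  sumTo-unfold n f with applyUpTo suc n
  ... | _ = refl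

sumToLoop-applyUpTo : ∀ n f (g : ℕ → ℕ) k → sumToLoop n f (applyUpTo g k) ≡ ∑[ i < k ] f (g i)
sumToLoop-applyUpTo n f g zero    = refl
sumToLoop-applyUpTo n f g (suc k) = cong (f (g 0) +q_) (sumToLoop-applyUpTo n f (g ∘ suc) k)

sumTo≡∑ : ∀ n f → sumTo n f ≡ ∑ (suc n) f
sumTo≡∑ n f = cong (f 0 +q_) (sumToLoop-applyUpTo n f suc n)

fromℚᵘ-homo-+ : ∀ p q → fromℚᵘ (p ℚᵘ.+ q) ≡ fromℚᵘ p +q fromℚᵘ q
fromℚᵘ-homo-+ p q = ℚP.toℚᵘ-injective (ℚᵘP.≃-trans (ℚP.toℚᵘ-fromℚᵘ (p ℚᵘ.+ q))
  (ℚᵘP.≃-sym (ℚᵘP.≃-trans (ℚP.toℚᵘ-homo-+ (fromℚᵘ p) (fromℚᵘ q))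
    (ℚᵘP.+-cong (ℚP.toℚᵘ-fromℚᵘ p) (ℚP.toℚᵘ-fromℚᵘ q)))))

fromℚᵘ-homo-* : ∀ p q → fromℚᵘ (p ℚᵘ.* q) ≡ fromℚᵘ p *q fromℚᵘ q
fromℚᵘ-homo-* p q = ℚP.toℚᵘ-injective (ℚᵘP.≃-trans (ℚP.toℚᵘ-fromℚᵘ (p ℚᵘ.* q))
  (ℚᵘP.≃-sym (ℚᵘP.≃-trans (ℚP.toℚᵘ-homo-* (fromℚᵘ p) (fromℚᵘ q))
    (ℚᵘP.*-cong (ℚP.toℚᵘ-fromℚᵘ p) (ℚP.toℚᵘ-fromℚᵘ q)))))

fromℚᵘ-homo‿- : ∀ p → fromℚᵘ (ℚᵘ.- p) ≡ -q fromℚᵘ p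
fromℚᵘ-homo‿- p = ℚP.toℚᵘ-injective (ℚᵘP.≃-trans (ℚP.toℚᵘ-fromℚᵘ (ℚᵘ.- p))
  (ℚᵘP.≃-sym (ℚᵘP.≃-trans (ℚP.toℚᵘ-homo‿- (fromℚᵘ p)) (ℚᵘP.-‿cong (ℚP.toℚᵘ-fromℚᵘ p)))))

ℤ→ℚ-homo-+ : ∀ a b → ℤ→ℚ (a ℤ.+ b) ≡ ℤ→ℚ a +q ℤ→ℚ b
ℤ→ℚ-homo-+ a b = trans (ℚP.fromℚᵘ-cong {mkℚᵘ (a ℤ.+ b) 0} {mkℚᵘ a 0 ℚᵘ.+ mkℚᵘ b 0}
    (*≡* (cong (ℤ._* + 1) (sym (cong₂ ℤ._+_ (ℤP.*-identityʳ a) (ℤP.*-identityʳ b))))))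
  (fromℚᵘ-homo-+ (mkℚᵘ a 0) (mkℚᵘ b 0))

ℤ→ℚ-homo-* : ∀ a b → ℤ→ℚ (a ℤ.* b) ≡ ℤ→ℚ a *q ℤ→ℚ b
ℤ→ℚ-homo-* a b = fromℚᵘ-homo-* (mkℚᵘ a 0) (mkℚᵘ b 0)

ℤ→ℚ-homo‿- : ∀ a → ℤ→ℚ (ℤ.- a) ≡ -q ℤ→ℚ a
ℤ→ℚ-homo‿- a = fromℚᵘ-homo‿- (mkℚᵘ a 0)

ℕ→ℚ : ℕ → ℚ
ℕ→ℚ n = ℤ→ℚ (+ n)

ℕ→ℚ-homo-+ : ∀ a b → ℕ→ℚ (a + b) ≡ ℕ→ℚ a +q ℕ→ℚ b
ℕ→ℚ-homo-+ a b = trans (cong ℤ→ℚ (ℤP.pos-+ a b)) (ℤ→ℚ-homo-+ (+ a) (+ b))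

ℕ→ℚ-homo-* : ∀ a b → ℕ→ℚ (a ℕ.* b) ≡ ℕ→ℚ a *q ℕ→ℚ b
ℕ→ℚ-homo-* a b = trans (cong ℤ→ℚ (ℤP.pos-* a b)) (ℤ→ℚ-homo-* (+ a) (+ b))

1/suc : ℕ → ℚ
1/suc n = + 1 / suc n

/suc≡*1/suc : ∀ a n → + a / suc n ≡ ℕ→ℚ a *q 1/suc n
/suc≡*1/suc a n = trans (ℚP.fromℚᵘ-cong {mkℚᵘ (+ a) n} {mkℚᵘ (+ a) 0 ℚᵘ.* mkℚᵘ (+ 1) n} (*≡* eq))
  (fromℚᵘ-homo-* (mkℚᵘ (+ a) 0) (mkℚᵘ (+ 1) n))
  where
  eq : + a ℤ.* + (1 ℕ.* suc n) ≡ (+ a ℤ.* + 1) ℤ.* + suc n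
  eq = cong₂ ℤ._*_ (sym (ℤP.*-identityʳ (+ a))) (cong +_ (ℕP.*-identityˡ (suc n)))

ℕ→ℚ-suc-*-1/suc : ∀ n → ℕ→ℚ (suc n) *q 1/suc n ≡ 1ℚ
ℕ→ℚ-suc-*-1/suc n = trans (sym (/suc≡*1/suc (suc n) n))
  (ℚP.fromℚᵘ-cong {mkℚᵘ (+ suc n) n} {mkℚᵘ (+ 1) 0} (*≡* (ℤP.*-comm (+ suc n) (+ 1))))

ℕ→ℚ-suc-*-cancel : ∀ n x → ℕ→ℚ (suc n) *q x *q 1/suc n ≡ x
ℕ→ℚ-suc-*-cancel n x = begin
  ℕ→ℚ (suc n) *q x *q 1/suc n
    ≡⟨ solve 3 (λ y x z → y :* x :* z := x :* (y :* z)) refl (ℕ→ℚ (suc n)) x (1/suc n) ⟩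
  x *q (ℕ→ℚ (suc n) *q 1/suc n)
    ≡⟨ cong (x *q_) (ℕ→ℚ-suc-*-1/suc n) ⟩
  x *q 1ℚ
    ≡⟨ ℚP.*-identityʳ x ⟩
  x ∎
  where open ≡-Reasoning

coeff-⊕ : ∀ p q k → coeff (p ⊕ q) k ≡ coeff p k ℤ.+ coeff q k
coeff-⊕ []      q       k       = sym (ℤP.+-identityˡ _)
coeff-⊕ (a ∷ p) []      k       = sym (ℤP.+-identityʳ _)
coeff-⊕ (a ∷ p) (b ∷ q) zero    = refl
coeff-⊕ (a ∷ p) (b ∷ q) (suc k) = coeff-⊕ p q k

coeff-map : ∀ (g : ℤ → ℤ) → g (+ 0) ≡ + 0 → ∀ p k → coeff (map g p) k ≡ g (coeff p k)
coeff-map g g0≡0 []      k       = sym g0≡0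
coeff-map g g0≡0 (a ∷ p) zero    = refl
coeff-map g g0≡0 (a ∷ p) (suc k) = coeff-map g g0≡0 p k

coeff-mulXminus : ∀ c p k → coeff (mulXminus c p) k ≡ coeff (+ 0 ∷ p) k ℤ.+ ℤ.- (c ℤ.* coeff p k)
coeff-mulXminus c p k = trans (coeff-⊕ (+ 0 ∷ p) (map (λ a → ℤ.- (c ℤ.* a)) p) k)
  (cong (λ a → coeff (+ 0 ∷ p) k ℤ.+ a) (coeff-map (λ a → ℤ.- (c ℤ.* a)) (cong ℤ.-_ (ℤP.*-zeroʳ c)) p k))

S₁-vanishing : ∀ n k → n < k → S₁ n k ≡ + 0
S₁-vanishing zero    (suc k) _         = refl
S₁-vanishing (suc n) (suc k) (s≤s n<k) = begin
  S₁ (suc n) (suc k)                               ≡⟨ coeff-mulXminus (+ n) (falling n) (suc k) ⟩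
  S₁ n k ℤ.+ ℤ.- (+ n ℤ.* S₁ n (suc k))            ≡⟨ cong₂ (λ a b → a ℤ.+ ℤ.- (+ n ℤ.* b))
                                                        (S₁-vanishing n k n<k) (S₁-vanishing n (suc k) (ℕP.m<n⇒m<1+n n<k)) ⟩
  + 0 ℤ.+ ℤ.- (+ n ℤ.* + 0)                        ≡⟨ ℤP.+-identityˡ _ ⟩
  ℤ.- (+ n ℤ.* + 0)                                ≡⟨ cong ℤ.-_ (ℤP.*-zeroʳ (+ n)) ⟩
  + 0                                              ∎
  where open ≡-Reasoning

S₁-suc-zero : ∀ n → S₁ (suc n) 0 ≡ + 0
S₁-suc-zero zero    = refl
S₁-suc-zero (suc n) = begin
  S₁ (suc (suc n)) 0                   ≡⟨ coeff-mulXminus (+ suc n) (falling (suc n)) 0 ⟩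
  + 0 ℤ.+ ℤ.- (+ suc n ℤ.* S₁ (suc n) 0) ≡⟨ ℤP.+-identityˡ _ ⟩
  ℤ.- (+ suc n ℤ.* S₁ (suc n) 0)       ≡⟨ cong (λ a → ℤ.- (+ suc n ℤ.* a)) (S₁-suc-zero n) ⟩
  ℤ.- (+ suc n ℤ.* + 0)                ≡⟨ cong ℤ.-_ (ℤP.*-zeroʳ (+ suc n)) ⟩
  + 0                                  ∎
  where open ≡-Reasoning

s₁ : ℕ → ℕ → ℚ
s₁ n k = ℤ→ℚ (S₁ n k)

s₁-suc : ∀ n k → s₁ (suc n) k ≡ ℤ→ℚ (coeff (+ 0 ∷ falling n) k) +q -q (ℕ→ℚ n *q s₁ n k)
s₁-suc n k = begin
  s₁ (suc n) k
    ≡⟨ cong ℤ→ℚ (coeff-mulXminus (+ n) (falling n) k) ⟩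
  ℤ→ℚ (coeff (+ 0 ∷ falling n) k ℤ.+ ℤ.- (+ n ℤ.* S₁ n k))
    ≡⟨ ℤ→ℚ-homo-+ (coeff (+ 0 ∷ falling n) k) (ℤ.- (+ n ℤ.* S₁ n k)) ⟩
  ℤ→ℚ (coeff (+ 0 ∷ falling n) k) +q ℤ→ℚ (ℤ.- (+ n ℤ.* S₁ n k))
    ≡⟨ cong (ℤ→ℚ (coeff (+ 0 ∷ falling n) k) +q_)
         (trans (ℤ→ℚ-homo‿- (+ n ℤ.* S₁ n k)) (cong -q_ (ℤ→ℚ-homo-* (+ n) (S₁ n k)))) ⟩
  ℤ→ℚ (coeff (+ 0 ∷ falling n) k) +q -q (ℕ→ℚ n *q s₁ n k) ∎
  where open ≡-Reasoning

s₁-suc-one : ∀ n → s₁ (suc n) 1 ≡ sgn n *q ℕ→ℚ (n !)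
s₁-suc-one zero    = refl
s₁-suc-one (suc n) = begin
  s₁ (suc (suc n)) 1
    ≡⟨ s₁-suc (suc n) 1 ⟩
  s₁ (suc n) 0 +q -q (ℕ→ℚ (suc n) *q s₁ (suc n) 1)
    ≡⟨ cong₂ (λ a b → ℤ→ℚ a +q -q (ℕ→ℚ (suc n) *q b)) (S₁-suc-zero n) (s₁-suc-one n) ⟩
  0ℚ +q -q (ℕ→ℚ (suc n) *q (sgn n *q ℕ→ℚ (n !)))
    ≡⟨ solve 3 (λ x g f → con 0ℚ :+ :- (x :* (g :* f)) := :- g :* (x :* f)) refl
         (ℕ→ℚ (suc n)) (sgn n) (ℕ→ℚ (n !)) ⟩
  -q sgn n *q (ℕ→ℚ (suc n) *q ℕ→ℚ (n !))
    ≡⟨ cong (-q sgn n *q_) (sym (ℕ→ℚ-homo-* (suc n) (n !))) ⟩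
  sgn (suc n) *q ℕ→ℚ (suc n !) ∎
  where open ≡-Reasoning

moment : ℕ → (ℕ → ℚ) → ℚ
moment n φ = ∑[ j < suc n ] (s₁ n j *q φ j)

moment-cong : ∀ n {φ ψ : ℕ → ℚ} → (∀ i → φ i ≡ ψ i) → moment n φ ≡ moment n ψ
moment-cong n φ≗ψ = ∑-cong (suc n) (λ i _ → cong (s₁ n i *q_) (φ≗ψ i))

moment-distrib-+ : ∀ n (φ ψ : ℕ → ℚ) → moment n (λ i → φ i +q ψ i) ≡ moment n φ +q moment n ψ
moment-distrib-+ n φ ψ = trans (∑-cong (suc n) (λ i _ → ℚP.*-distribˡ-+ (s₁ n i) (φ i) (ψ i)))
  (∑-distrib-+ (suc n) (λ i → s₁ n i *q φ i) (λ i → s₁ n i *q ψ i))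

-- (x)ₙ₊₁ = x (x)ₙ - n (x)ₙ, and L_φ(x p) = L_{φ ∘ suc}(p).
moment-suc : ∀ n φ → moment (suc n) φ ≡ moment n (φ ∘ suc) +q -q (ℕ→ℚ n *q moment n φ)
moment-suc n φ = begin
  s₁ (suc n) 0 *q φ 0 +q ∑[ j < suc n ] (s₁ (suc n) (suc j) *q φ (suc j))
    ≡⟨ cong₂ _+q_ (cong (_*q φ 0) (s₁-suc n 0)) (∑-cong (suc n) (λ j _ → split j)) ⟩
  (0ℚ +q -q (x *q s₁ n 0)) *q φ 0 +q ∑[ j < suc n ] (s₁ n j *q φ (suc j) +q -q (x *q T j))
    ≡⟨ cong ((0ℚ +q -q (x *q s₁ n 0)) *q φ 0 +q_)
         (sym (∑-sub-scaled (suc n) x (λ j → s₁ n j *q φ (suc j)) T)) ⟩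
  (0ℚ +q -q (x *q s₁ n 0)) *q φ 0 +q (moment n (φ ∘ suc) +q -q (x *q ∑ (suc n) T))
    ≡⟨ cong (λ t → (0ℚ +q -q (x *q s₁ n 0)) *q φ 0 +q (moment n (φ ∘ suc) +q -q (x *q t))) top-vanishes ⟩
  (0ℚ +q -q (x *q s₁ n 0)) *q φ 0 +q (moment n (φ ∘ suc) +q -q (x *q ∑ n T))
    ≡⟨ solve 5 (λ x a p e t → (con 0ℚ :+ :- (x :* a)) :* p :+ (e :+ :- (x :* t)) := e :+ :- (x :* (a :* p :+ t)))
         refl x (s₁ n 0) (φ 0) (moment n (φ ∘ suc)) (∑ n T) ⟩
  moment n (φ ∘ suc) +q -q (x *q moment n φ) ∎
  where
  open ≡-Reasoning
  x : ℚ
  x = ℕ→ℚ n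
  T : ℕ → ℚ
  T j = s₁ n (suc j) *q φ (suc j)
  split : ∀ j → s₁ (suc n) (suc j) *q φ (suc j) ≡ s₁ n j *q φ (suc j) +q -q (x *q T j)
  split j = trans (cong (_*q φ (suc j)) (s₁-suc n (suc j)))
    (solve 4 (λ a x b p → (a :+ :- (x :* b)) :* p := a :* p :+ :- (x :* (b :* p))) refl
       (s₁ n j) x (s₁ n (suc j)) (φ (suc j)))
  top-vanishes : ∑ (suc n) T ≡ ∑ n T
  top-vanishes = begin
    ∑ (suc n) T                            ≡⟨ ∑-last n T ⟩
    ∑ n T +q s₁ n (suc n) *q φ (suc n)
      ≡⟨ cong (λ a → ∑ n T +q ℤ→ℚ a *q φ (suc n)) (S₁-vanishing n (suc n) (ℕP.n<1+n n)) ⟩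
    ∑ n T +q 0ℚ *q φ (suc n)               ≡⟨ cong (∑ n T +q_) (ℚP.*-zeroˡ (φ (suc n))) ⟩
    ∑ n T +q 0ℚ                            ≡⟨ ℚP.+-identityʳ (∑ n T) ⟩
    ∑ n T                                  ∎

moment-∘suc : ∀ n φ → moment n (φ ∘ suc) ≡ moment (suc n) φ +q ℕ→ℚ n *q moment n φ
moment-∘suc n φ = sym (trans (cong (_+q ℕ→ℚ n *q moment n φ) (moment-suc n φ))
  (solve 3 (λ a x e → a :+ :- (x :* e) :+ x :* e := a) refl (moment n (φ ∘ suc)) (ℕ→ℚ n) (moment n φ)))

moment-zero : ∀ φ → moment 0 φ ≡ φ 0
moment-zero φ = trans (ℚP.+-identityʳ (1ℚ *q φ 0)) (ℚP.*-identityˡ (φ 0))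

moment-∘suc-sub : ∀ N a n φ → N ≡ a + n →
  moment N (φ ∘ suc) +q -q (ℕ→ℚ n *q moment N φ) ≡ moment (suc N) φ +q ℕ→ℚ a *q moment N φ
moment-∘suc-sub N a n φ refl = begin
  moment N (φ ∘ suc) +q -q (ℕ→ℚ n *q moment N φ)
    ≡⟨ cong (_+q -q (ℕ→ℚ n *q moment N φ)) (moment-∘suc N φ) ⟩
  moment (suc N) φ +q ℕ→ℚ (a + n) *q moment N φ +q -q (ℕ→ℚ n *q moment N φ)
    ≡⟨ cong (λ x → moment (suc N) φ +q x *q moment N φ +q -q (ℕ→ℚ n *q moment N φ)) (ℕ→ℚ-homo-+ a n) ⟩
  moment (suc N) φ +q (ℕ→ℚ a +q ℕ→ℚ n) *q moment N φ +q -q (ℕ→ℚ n *q moment N φ)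
    ≡⟨ solve 4 (λ e a n f → e :+ (a :+ n) :* f :+ :- (n :* f) := e :+ a :* f) refl
         (moment (suc N) φ) (ℕ→ℚ a) (ℕ→ℚ n) (moment N φ) ⟩
  moment (suc N) φ +q ℕ→ℚ a *q moment N φ ∎
  where open ≡-Reasoning

-- Δ φ i = L_φ((x+1)ⁱ - xⁱ).
Δ : (ℕ → ℚ) → ℕ → ℚ
Δ φ i = ∑[ k < i ] (ℕ→ℚ (i C k) *q φ k)

Δ-suc : ∀ φ i → Δ φ (suc i) ≡ φ i +q Δ φ i +q Δ (φ ∘ suc) i
Δ-suc φ i = begin
  ℕ→ℚ 1 *q φ 0 +q ∑[ k < i ] (ℕ→ℚ (suc i C suc k) *q φ (suc k))
    ≡⟨ cong (ℕ→ℚ 1 *q φ 0 +q_)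
         (trans (∑-cong i (λ k _ → pascal k)) (∑-distrib-+ i (λ k → ℕ→ℚ (i C k) *q φ (suc k)) W)) ⟩
  ℕ→ℚ 1 *q φ 0 +q (Δ (φ ∘ suc) i +q ∑ i W)
    ≡⟨ solve 4 (λ o p d w → o :* p :+ (d :+ w) := (o :* p :+ w) :+ d) refl
         (ℕ→ℚ 1) (φ 0) (Δ (φ ∘ suc) i) (∑ i W) ⟩
  ∑[ k < suc i ] (ℕ→ℚ (i C k) *q φ k) +q Δ (φ ∘ suc) i
    ≡⟨ cong (_+q Δ (φ ∘ suc) i) (∑-last i (λ k → ℕ→ℚ (i C k) *q φ k)) ⟩
  Δ φ i +q ℕ→ℚ (i C i) *q φ i +q Δ (φ ∘ suc) i
    ≡⟨ cong (λ c → Δ φ i +q ℕ→ℚ c *q φ i +q Δ (φ ∘ suc) i) (nCn≡1 i) ⟩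
  Δ φ i +q 1ℚ *q φ i +q Δ (φ ∘ suc) i
    ≡⟨ solve 3 (λ d p e → d :+ con 1ℚ :* p :+ e := p :+ d :+ e) refl (Δ φ i) (φ i) (Δ (φ ∘ suc) i) ⟩
  φ i +q Δ φ i +q Δ (φ ∘ suc) i ∎
  where
  open ≡-Reasoning
  W : ℕ → ℚ
  W k = ℕ→ℚ (i C suc k) *q φ (suc k)
  pascal : ∀ k → ℕ→ℚ (suc i C suc k) *q φ (suc k) ≡ ℕ→ℚ (i C k) *q φ (suc k) +q W k
  pascal k = begin
    ℕ→ℚ (suc i C suc k) *q φ (suc k)
      ≡⟨ cong (λ c → ℕ→ℚ c *q φ (suc k)) (sym (nCk+nC[k+1]≡[n+1]C[k+1] i k)) ⟩
    ℕ→ℚ (i C k + i C suc k) *q φ (suc k)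
      ≡⟨ cong (_*q φ (suc k)) (ℕ→ℚ-homo-+ (i C k) (i C suc k)) ⟩
    (ℕ→ℚ (i C k) +q ℕ→ℚ (i C suc k)) *q φ (suc k)
      ≡⟨ ℚP.*-distribʳ-+ (φ (suc k)) (ℕ→ℚ (i C k)) (ℕ→ℚ (i C suc k)) ⟩
    ℕ→ℚ (i C k) *q φ (suc k) +q W k ∎

moment-Δ : ∀ n φ → moment (suc n) (Δ φ) ≡ ℕ→ℚ (suc n) *q moment n φ
moment-Δ zero    φ = solve 1 (λ p → con 0ℚ :* con 0ℚ :+ (con 1ℚ :* (con 1ℚ :* p :+ con 0ℚ) :+ con 0ℚ)
                                    := con 1ℚ :* (con 1ℚ :* p :+ con 0ℚ)) refl (φ 0)
moment-Δ (suc n) φ = begin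
  moment (suc (suc n)) (Δ φ)
    ≡⟨ moment-suc (suc n) (Δ φ) ⟩
  moment (suc n) (Δ φ ∘ suc) +q -q (x′ *q moment (suc n) (Δ φ))
    ≡⟨ cong (_+q -q (x′ *q moment (suc n) (Δ φ))) (trans (moment-cong (suc n) (Δ-suc φ))
         (trans (moment-distrib-+ (suc n) (λ j → φ j +q Δ φ j) (Δ (φ ∘ suc)))
           (cong (_+q moment (suc n) (Δ (φ ∘ suc))) (moment-distrib-+ (suc n) φ (Δ φ))))) ⟩
  moment (suc n) φ +q moment (suc n) (Δ φ) +q moment (suc n) (Δ (φ ∘ suc)) +q -q (x′ *q moment (suc n) (Δ φ))
    ≡⟨ cong₂ (λ u v → moment (suc n) φ +q u +q v +q -q (x′ *q u)) (moment-Δ n φ) (moment-Δ n (φ ∘ suc)) ⟩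
  moment (suc n) φ +q x′ *q b +q x′ *q a +q -q (x′ *q (x′ *q b))
    ≡⟨ cong₂ (λ u w → u +q w *q b +q w *q a +q -q (w *q (w *q b))) (moment-suc n φ) (ℕ→ℚ-homo-+ 1 n) ⟩
  (a +q -q (x *q b)) +q (1ℚ +q x) *q b +q (1ℚ +q x) *q a +q -q ((1ℚ +q x) *q ((1ℚ +q x) *q b))
    ≡⟨ solve 3 (λ a b x → (a :+ :- (x :* b)) :+ (con 1ℚ :+ x) :* b :+ (con 1ℚ :+ x) :* a
                            :+ :- ((con 1ℚ :+ x) :* ((con 1ℚ :+ x) :* b))
                          := (con 1ℚ :+ (con 1ℚ :+ x)) :* (a :+ :- (x :* b))) refl a b x ⟩
  (1ℚ +q (1ℚ +q x)) *q (a +q -q (x *q b))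
    ≡⟨ sym (cong₂ _*q_ (trans (ℕ→ℚ-homo-+ 1 (suc n)) (cong (1ℚ +q_) (ℕ→ℚ-homo-+ 1 n))) (moment-suc n φ)) ⟩
  ℕ→ℚ (suc (suc n)) *q moment (suc n) φ ∎
  where
  open ≡-Reasoning
  a b x x′ : ℚ
  a = moment n (φ ∘ suc)
  b = moment n φ
  x = ℕ→ℚ n
  x′ = ℕ→ℚ (suc n)

-- The recursion for `B` accumulates over a table of earlier values, both local to its definition;
-- as for `sumTo`, they are recovered by unification: `bernoulliAcc n i k` is the accumulator of
-- step `n` started at index `i` on the table of `B k, …, B 0`.
B-suc-suc : ∀ k → Σ ℚ λ rest →
  B (suc (suc k)) ≡ -q (1/suc (suc (suc k)) *q (ℕ→ℚ (suc (suc (suc k)) C suc k) *q B (suc k) +q rest))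
B-suc-suc k = _ , refl

mutual
  bernoulliAcc : ℕ → ℕ → ℕ → ℚ
  bernoulliAcc = _

  bernoulliAcc-captured : ∀ k → bernoulliAcc (suc k) 1 k ≡ proj₁ (B-suc-suc k)
  bernoulliAcc-captured k with suc k | 1
  ... | _ | _ = refl

bernoulliAcc≡∑ : ∀ n i k → i + k ≡ n → bernoulliAcc n i k ≡ ∑[ t < suc k ] (ℕ→ℚ (suc (suc n) C t) *q B t)
bernoulliAcc≡∑ n i zero    refl = cong (λ t → ℕ→ℚ (suc (suc n) C t) *q 1ℚ +q 0ℚ) (ℕP.m+n∸m≡n i 0)
bernoulliAcc≡∑ n i (suc k) refl = begin
  ℕ→ℚ (suc (suc n) C (n ∸ i)) *q B (suc k) +q bernoulliAcc n (suc i) k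
    ≡⟨ cong₂ (λ t r → ℕ→ℚ (suc (suc n) C t) *q B (suc k) +q r)
         (ℕP.m+n∸m≡n i (suc k)) (bernoulliAcc≡∑ n (suc i) k (sym (ℕP.+-suc i k))) ⟩
  G (suc k) +q ∑ (suc k) G
    ≡⟨ ℚP.+-comm (G (suc k)) (∑ (suc k) G) ⟩
  ∑ (suc k) G +q G (suc k)
    ≡⟨ sym (∑-last (suc k) G) ⟩
  ∑ (suc (suc k)) G ∎
  where
  open ≡-Reasoning
  G : ℕ → ℚ
  G t = ℕ→ℚ (suc (suc n) C t) *q B t

Δ-bernoulli : ∀ n → Δ B (suc (suc n)) ≡ 0ℚ
Δ-bernoulli n = begin
  ∑ (suc (suc n)) G
    ≡⟨ ∑-last (suc n) G ⟩
  ∑ (suc n) G +q ℕ→ℚ (suc (suc n) C suc n) *q B (suc n)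
    ≡⟨ cong₂ (λ u c → u +q ℕ→ℚ c *q B (suc n)) (sym (bernoulliAcc≡∑ n 0 n refl)) C[2+n,1+n]≡2+n ⟩
  A +q ℕ→ℚ (suc (suc n)) *q -q (1/suc (suc n) *q A)
    ≡⟨ solve 3 (λ a y z → a :+ y :* :- (z :* a) := a :+ :- ((y :* z) :* a)) refl
         A (ℕ→ℚ (suc (suc n))) (1/suc (suc n)) ⟩
  A +q -q ((ℕ→ℚ (suc (suc n)) *q 1/suc (suc n)) *q A)
    ≡⟨ cong (λ u → A +q -q (u *q A)) (ℕ→ℚ-suc-*-1/suc (suc n)) ⟩
  A +q -q (1ℚ *q A)
    ≡⟨ solve 1 (λ a → a :+ :- (con 1ℚ :* a) := con 0ℚ) refl A ⟩
  0ℚ ∎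
  where
  open ≡-Reasoning
  G : ℕ → ℚ
  G t = ℕ→ℚ (suc (suc n) C t) *q B t
  A : ℚ
  A = bernoulliAcc n 0 n
  C[2+n,1+n]≡2+n : suc (suc n) C suc n ≡ suc (suc n)
  C[2+n,1+n]≡2+n = trans (nCk≡nC[n∸k] (ℕP.n≤1+n (suc n)))
    (trans (cong (suc (suc n) C_) (ℕP.m+n∸n≡m 1 (suc n))) (nC1≡n (suc (suc n))))

moment-bernoulli : ∀ n → moment n B ≡ sgn n *q ℕ→ℚ (n !) *q 1/suc n
moment-bernoulli n = begin
  moment n B
    ≡⟨ sym (ℕ→ℚ-suc-*-cancel n (moment n B)) ⟩
  (ℕ→ℚ (suc n) *q moment n B) *q 1/suc n
    ≡⟨ cong (_*q 1/suc n) (sym (moment-Δ n B)) ⟩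
  moment (suc n) (Δ B) *q 1/suc n
    ≡⟨ cong (_*q 1/suc n) ΔB-moment ⟩
  s₁ (suc n) 1 *q 1/suc n
    ≡⟨ cong (_*q 1/suc n) (s₁-suc-one n) ⟩
  sgn n *q ℕ→ℚ (n !) *q 1/suc n ∎
  where
  open ≡-Reasoning
  ΔB-moment : moment (suc n) (Δ B) ≡ s₁ (suc n) 1
  ΔB-moment = begin
    s₁ (suc n) 0 *q 0ℚ +q (s₁ (suc n) 1 *q 1ℚ +q ∑[ j < n ] (s₁ (suc n) (suc (suc j)) *q Δ B (suc (suc j))))
      ≡⟨ cong (λ r → s₁ (suc n) 0 *q 0ℚ +q (s₁ (suc n) 1 *q 1ℚ +q r))
           (∑-vanishing n (λ j _ → trans (cong (s₁ (suc n) (suc (suc j)) *q_) (Δ-bernoulli j))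
                                         (ℚP.*-zeroʳ (s₁ (suc n) (suc (suc j)))))) ⟩
    s₁ (suc n) 0 *q 0ℚ +q (s₁ (suc n) 1 *q 1ℚ +q 0ℚ)
      ≡⟨ solve 2 (λ a b → a :* con 0ℚ :+ (b :* con 1ℚ :+ con 0ℚ) := b) refl (s₁ (suc n) 0) (s₁ (suc n) 1) ⟩
    s₁ (suc n) 1 ∎

matchingSum : ℕ → ℕ → (ℕ → ℚ) → ℚ
matchingSum m n φ = ∑[ k < suc m ] (ℕ→ℚ (matchings m n k) *q moment (m + n ∸ k) φ)

matchingSum-zero : ∀ m φ → matchingSum m 0 φ ≡ moment m φ
matchingSum-zero m φ = begin
  1ℚ *q moment (m + 0) φ +q ∑[ k < m ] (ℕ→ℚ (matchings m 0 (suc k)) *q moment (m + 0 ∸ suc k) φ)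
    ≡⟨ cong₂ (λ N r → 1ℚ *q moment N φ +q r) (ℕP.+-identityʳ m) (∑-vanishing m (λ k _ → no-matchings k)) ⟩
  1ℚ *q moment m φ +q 0ℚ
    ≡⟨ trans (ℚP.+-identityʳ (1ℚ *q moment m φ)) (ℚP.*-identityˡ (moment m φ)) ⟩
  moment m φ ∎
  where
  open ≡-Reasoning
  no-matchings : ∀ k → ℕ→ℚ (matchings m 0 (suc k)) *q moment (m + 0 ∸ suc k) φ ≡ 0ℚ
  no-matchings k = trans (cong (λ c → ℕ→ℚ (c ℕ.* (suc k !)) *q moment (m + 0 ∸ suc k) φ) (ℕP.*-zeroʳ (m C suc k)))
    (ℚP.*-zeroˡ (moment (m + 0 ∸ suc k) φ))

module MatchingSumStep (m n : ℕ) (φ : ℕ → ℚ) where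

  c : ℕ → ℚ
  c k = ℕ→ℚ (matchings m n k)

  N : ℕ → ℕ
  N k = m + n ∸ k

  U V : ℕ → ℚ
  U k = c k *q moment (suc (N k)) φ
  V k = c k *q ℕ→ℚ (m ∸ k) *q moment (N k) φ

  split : ∀ k → k ≤ m → c k *q moment (N k) (φ ∘ suc) +q -q (ℕ→ℚ n *q (c k *q moment (N k) φ)) ≡ U k +q V k
  split k k≤m = begin
    c k *q moment (N k) (φ ∘ suc) +q -q (ℕ→ℚ n *q (c k *q moment (N k) φ))
      ≡⟨ solve 4 (λ c e x f → c :* e :+ :- (x :* (c :* f)) := c :* (e :+ :- (x :* f))) refl
           (c k) (moment (N k) (φ ∘ suc)) (ℕ→ℚ n) (moment (N k) φ) ⟩
    c k *q (moment (N k) (φ ∘ suc) +q -q (ℕ→ℚ n *q moment (N k) φ))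
      ≡⟨ cong (c k *q_) (moment-∘suc-sub (N k) (m ∸ k) n φ (ℕP.+-∸-comm n k≤m)) ⟩
    c k *q (moment (suc (N k)) φ +q ℕ→ℚ (m ∸ k) *q moment (N k) φ)
      ≡⟨ solve 4 (λ c e d f → c :* (e :+ d :* f) := c :* e :+ c :* d :* f) refl
           (c k) (moment (suc (N k)) φ) (ℕ→ℚ (m ∸ k)) (moment (N k) φ) ⟩
    U k +q V k ∎
    where open ≡-Reasoning

  V-top : V m ≡ 0ℚ
  V-top = begin
    c m *q ℕ→ℚ (m ∸ m) *q moment (N m) φ   ≡⟨ cong (λ d → c m *q ℕ→ℚ d *q moment (N m) φ) (ℕP.n∸n≡0 m) ⟩
    c m *q 0ℚ *q moment (N m) φ            ≡⟨ cong (_*q moment (N m) φ) (ℚP.*-zeroʳ (c m)) ⟩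
    0ℚ *q moment (N m) φ                   ≡⟨ ℚP.*-zeroˡ (moment (N m) φ) ⟩
    0ℚ                                     ∎
    where open ≡-Reasoning

  merge : ∀ k → k < m → ℕ→ℚ (matchings m (suc n) (suc k)) *q moment (m + suc n ∸ suc k) φ ≡ U (suc k) +q V k
  merge k k<m = begin
    ℕ→ℚ (matchings m (suc n) (suc k)) *q moment (m + suc n ∸ suc k) φ
      ≡⟨ cong₂ (λ a N → ℕ→ℚ a *q moment (N ∸ suc k) φ) (matchings-suc m n k) (ℕP.+-suc m n) ⟩
    ℕ→ℚ (matchings m n (suc k) + matchings m n k ℕ.* (m ∸ k)) *q moment (N k) φ
      ≡⟨ cong (_*q moment (N k) φ) (trans (ℕ→ℚ-homo-+ (matchings m n (suc k)) _)
           (cong (c (suc k) +q_) (ℕ→ℚ-homo-* (matchings m n k) (m ∸ k)))) ⟩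
    (c (suc k) +q c k *q ℕ→ℚ (m ∸ k)) *q moment (N k) φ
      ≡⟨ ℚP.*-distribʳ-+ (moment (N k) φ) (c (suc k)) (c k *q ℕ→ℚ (m ∸ k)) ⟩
    c (suc k) *q moment (N k) φ +q V k
      ≡⟨ cong (λ M → c (suc k) *q moment M φ +q V k)
           (ℕP.+-∸-assoc 1 {m + n} {suc k} (ℕP.≤-trans k<m (ℕP.m≤m+n m n))) ⟩
    U (suc k) +q V k ∎
    where open ≡-Reasoning

matchingSum-suc : ∀ m n φ →
  matchingSum m (suc n) φ ≡ matchingSum m n (φ ∘ suc) +q -q (ℕ→ℚ n *q matchingSum m n φ)
matchingSum-suc m n φ = sym (begin
  matchingSum m n (φ ∘ suc) +q -q (ℕ→ℚ n *q matchingSum m n φ)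
    ≡⟨ ∑-sub-scaled (suc m) (ℕ→ℚ n) (λ k → c k *q moment (N k) (φ ∘ suc)) (λ k → c k *q moment (N k) φ) ⟩
  ∑[ k < suc m ] (c k *q moment (N k) (φ ∘ suc) +q -q (ℕ→ℚ n *q (c k *q moment (N k) φ)))
    ≡⟨ ∑-cong (suc m) (λ k k<1+m → split k (ℕP.≤-pred k<1+m)) ⟩
  ∑[ k < suc m ] (U k +q V k)
    ≡⟨ ∑-distrib-+ (suc m) U V ⟩
  ∑ (suc m) U +q ∑ (suc m) V
    ≡⟨ ∑-merge-shifted m U V ⟩
  U 0 +q ∑[ k < m ] (U (suc k) +q V k) +q V m
    ≡⟨ trans (cong (U 0 +q ∑[ k < m ] (U (suc k) +q V k) +q_) V-top) (ℚP.+-identityʳ _) ⟩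
  U 0 +q ∑[ k < m ] (U (suc k) +q V k)
    ≡⟨ sym (cong₂ _+q_ (cong (λ N → c 0 *q moment N φ) (ℕP.+-suc m n)) (∑-cong m merge)) ⟩
  matchingSum m (suc n) φ ∎)
  where
  open ≡-Reasoning
  open MatchingSumStep m n φ

moment-product : ∀ m n φ → moment n (λ j → moment m (λ l → φ (j + l))) ≡ matchingSum m n φ
moment-product m zero    φ = trans (moment-zero (λ j → moment m (λ l → φ (j + l)))) (sym (matchingSum-zero m φ))
moment-product m (suc n) φ = begin
  moment (suc n) ψ
    ≡⟨ moment-suc n ψ ⟩
  moment n (ψ ∘ suc) +q -q (ℕ→ℚ n *q moment n ψ)
    ≡⟨ cong₂ (λ a b → a +q -q (ℕ→ℚ n *q b)) (moment-product m n (φ ∘ suc)) (moment-product m n φ) ⟩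
  matchingSum m n (φ ∘ suc) +q -q (ℕ→ℚ n *q matchingSum m n φ)
    ≡⟨ sym (matchingSum-suc m n φ) ⟩
  matchingSum m (suc n) φ ∎
  where
  open ≡-Reasoning
  ψ : ℕ → ℚ
  ψ j = moment m (λ l → φ (j + l))

scaled-moment-bernoulli : ∀ a N → ℕ→ℚ a *q moment N B ≡ sgn N *q (+ (a ℕ.* N !) / suc N)
scaled-moment-bernoulli a N = begin
  ℕ→ℚ a *q moment N B
    ≡⟨ cong (ℕ→ℚ a *q_) (moment-bernoulli N) ⟩
  ℕ→ℚ a *q (sgn N *q ℕ→ℚ (N !) *q 1/suc N)
    ≡⟨ solve 4 (λ a g f i → a :* (g :* f :* i) := g :* (a :* f :* i)) refl
         (ℕ→ℚ a) (sgn N) (ℕ→ℚ (N !)) (1/suc N) ⟩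
  sgn N *q (ℕ→ℚ a *q ℕ→ℚ (N !) *q 1/suc N)
    ≡⟨ cong (λ x → sgn N *q (x *q 1/suc N)) (sym (ℕ→ℚ-homo-* a (N !))) ⟩
  sgn N *q (ℕ→ℚ (a ℕ.* N !) *q 1/suc N)
    ≡⟨ cong (sgn N *q_) (sym (/suc≡*1/suc (a ℕ.* N !) N)) ⟩
  sgn N *q (+ (a ℕ.* N !) / suc N) ∎
  where open ≡-Reasoning

mainTheorem15 : (m n : ℕ) →
    sumTo n (λ j → sumTo m (λ l →
        ℤ→ℚ (S₁ n j) ℚ.* ℤ→ℚ (S₁ m l) ℚ.* B (j + l)))
      ≡ sumTo m (λ k →
        sgn (m + n ∸ k) ℚ.* ((+ ((m C k) ℕ.* (n C k) ℕ.* (k !) ℕ.* ((m + n ∸ k) !))) / ℕ.suc (m + n ∸ k)))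
mainTheorem15 m n = begin
  sumTo n (λ j → sumTo m (λ l → s₁ n j *q s₁ m l *q B (j + l)))
    ≡⟨ sumTo≡∑ n (λ j → sumTo m (λ l → s₁ n j *q s₁ m l *q B (j + l))) ⟩
  ∑[ j < suc n ] sumTo m (λ l → s₁ n j *q s₁ m l *q B (j + l))
    ≡⟨ ∑-cong (suc n) (λ j _ → inner j) ⟩
  moment n (λ j → moment m (λ l → B (j + l)))
    ≡⟨ moment-product m n B ⟩
  matchingSum m n B
    ≡⟨ ∑-cong (suc m) (λ k _ → scaled-moment-bernoulli (matchings m n k) (m + n ∸ k)) ⟩
  ∑ (suc m) term
    ≡⟨ sym (sumTo≡∑ m term) ⟩
  sumTo m term ∎
  where
  open ≡-Reasoning
  term : ℕ → ℚ
  term k = sgn (m + n ∸ k) *q (+ (matchings m n k ℕ.* (m + n ∸ k) !) / suc (m + n ∸ k))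
  inner : ∀ j → sumTo m (λ l → s₁ n j *q s₁ m l *q B (j + l)) ≡ s₁ n j *q moment m (λ l → B (j + l))
  inner j = begin
    sumTo m (λ l → s₁ n j *q s₁ m l *q B (j + l))
      ≡⟨ sumTo≡∑ m (λ l → s₁ n j *q s₁ m l *q B (j + l)) ⟩
    ∑[ l < suc m ] (s₁ n j *q s₁ m l *q B (j + l))
      ≡⟨ ∑-cong (suc m) (λ l _ → ℚP.*-assoc (s₁ n j) (s₁ m l) (B (j + l))) ⟩
    ∑[ l < suc m ] (s₁ n j *q (s₁ m l *q B (j + l)))
      ≡⟨ ∑-distribˡ-* (suc m) (s₁ n j) (λ l → s₁ m l *q B (j + l)) ⟩
    s₁ n j *q moment m (λ l → B (j + l)) ∎
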